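{- Let $r\in\mathbb{N}_{\ge3}$, $K\subseteq\{1,\ldots,r-2\}$ nonempty, $C=C_{r,K}$, and let $k_1<m_1<k_2<m_2<\cdots<k_l<m_l$ and $M$ be as in the context. Let $d\in D$, and let $n\in\mathbb{N}_{>0}$, $b_1,\ldots,b_{n-1}\in\{0,\ldots,r-1\}\setminus K$ and $m_j\in M$ be such that $d=\sum_{i=1}^{n-1}b_ir^{ -i}+m_jr^{ -n}$. Then the length of the complementary interval of $C$ with right endpoint $d$ is $(m_j-k_j)r^{ -n}$.
   Context: $C_{r,K}$ is the set of numbers in $[0,1]$ admitting a base $r$ expansion (digits in $\{0,\ldots,r-1\}$) omitting the digits in $K$. Let $k_1,\ldots,k_l\in K$ and $m_1,\ldots,m_l\in\{0,\ldots,r-1\}\setminus K$ be such that $k_1<m_1<\cdots<k_l<m_l$ and $K=\mathbb{N}\cap\bigcup_{i=1}^l[k_i,m_i)$; set $M=\{m_1,\ldots,m_l\}$. A complementary interval of $C$ is an open interval $(c_1,c_2)\subseteq[0,1]$ with $c_1,c_2\in C$ and $(c_1,c_2)\cap C=\emptyset$. $D$ is the set of right endpoints of complementary intervals of $C$. -}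

module Defs where

open import Data.Nat as ℕ using (ℕ; zero; suc; _∸_)
open import Data.Integer using (+_)
open import Data.Rational using (ℚ; _/_; _+_; _*_; _-_; 0ℚ; 1ℚ)
import Data.Rational as Q
open import Data.Fin using (Fin; inject₁; fromℕ)
open import Data.Product using (Σ; ∃; _×_)
open import Relation.Nullary using (¬_)

-- Real numbers of C_{r,K} are represented by their base-r digit sequences
-- a : ℕ → ℕ, where a i is the (i+1)-th digit after the radix point,
-- i.e. the represented number is Σ_{i≥0} a i · r^{-(i+1)}.

-- 1/r as a rational (only used with r ≥ 3; value at 0 is irrelevant)
inv : ℕ → ℚ
inv zero = 0ℚ
inv (suc k) = + 1 / suc k

w : ℕ → ℕ → ℚ
w r zero = 1ℚ
w r (suc N) = inv r * w r N

toℚ : ℕ → ℚ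
toℚ n = + n / 1

S : ℕ → (ℕ → ℕ) → ℕ → ℚ
S r a zero = 0ℚ
S r a (suc N) = S r a N + toℚ (a N) * w r (suc N)

-- finite sum Σ_{i=1}^{n} b_i r^{-i} for b : Fin n → ℕ (b at index i is digit b_{i+1})
Sfin : (r : ℕ) {n : ℕ} → (Fin n → ℕ) → ℚ
Sfin r {zero} b = 0ℚ
Sfin r {suc n} b = Sfin r (λ i → b (inject₁ i)) + toℚ (b (fromℕ n)) * w r (suc n)

Admissible : (r : ℕ) (K : ℕ → Set) → (ℕ → ℕ) → Set
Admissible r K a = ∀ i → (a i ℕ.< r) × ¬ K (a i)

HasValue : ℕ → (ℕ → ℕ) → ℚ → Set
HasValue r a q = ∀ N → (S r a N Q.≤ q) × (q Q.≤ S r a N + w r N)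

SeqLtQ : ℕ → (ℕ → ℕ) → ℚ → Set
SeqLtQ r a q = ∃ λ N → S r a N + w r N Q.< q

SeqLt : ℕ → (ℕ → ℕ) → (ℕ → ℕ) → Set
SeqLt r a b = ∃ λ N → S r a N + w r N Q.< S r b N

InCℚ : (r : ℕ) (K : ℕ → Set) → ℚ → Set
InCℚ r K q = Σ (ℕ → ℕ) λ a → Admissible r K a × HasValue r a q

CompInterval : (r : ℕ) (K : ℕ → Set) → (ℕ → ℕ) → ℚ → Set
CompInterval r K c d =
  Admissible r K c × InCℚ r K d × SeqLtQ r c d ×
  (∀ x → Admissible r K x → ¬ (SeqLt r c x × SeqLtQ r x d))

InD : (r : ℕ) (K : ℕ → Set) → ℚ → Set
InD r K d = Σ (ℕ → ℕ) λ c → CompInterval r K c d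

-- Let y be the expansion b₁ … bₙ₋₁ (kⱼ − 1) (r − 1) (r − 1) …; its digits avoid K and its value is
-- 0.b₁…bₙ₋₁kⱼ = d − (mⱼ − kⱼ) r⁻ⁿ. The left endpoint c of the gap lies below d, so the integer
-- formed by its first n − 1 digits does not exceed b₁…bₙ₋₁, and in case of equality its n-th digit,
-- being outside [kⱼ, mⱼ) ⊆ K, is below kⱼ: hence c ≤ y. If c < y, then y would lie in the gap
-- (c, d). All comparisons are made between integer numerals scaled by powers of r.

module Submission where

open import Defs
open import Data.Nat as ℕ using (ℕ; zero; suc; _≤_; _<_; _∸_; _^_; s≤s; z≤n)
import Data.Nat.Properties as ℕP
open import Algebra.Properties.CommutativeSemigroup ℕP.*-commutativeSemigroup using (x∙yz≈y∙xz)
import Data.Integer as ℤ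
open import Data.Integer using (1ℤ)
import Data.Integer.Properties as ℤP
open import Data.Integer.Solver using () renaming (module +-*-Solver to ℤSolver)
open import Data.Rational as ℚ using (ℚ; _+_; _*_; _-_; 1ℚ; mkℚ; toℚᵘ)
import Data.Rational.Properties as ℚP
open import Data.Rational.Solver using () renaming (module +-*-Solver to ℚSolver)
import Data.Rational.Unnormalised as ℚᵘ
import Data.Rational.Unnormalised.Properties as ℚᵘP
open import Data.Nat.Coprimality as Coprime using (1-coprimeTo)
open import Data.Fin using (Fin)
import Data.Fin as F
import Data.Fin.Properties as FP
open import Data.Product using (∃; _×_; _,_; proj₁; proj₂)
open import Data.Sum using (inj₁; inj₂)
open import Data.Empty using (⊥-elim)
open import Function using (_∘_)
open import Function.Bundles using (_⇔_; Equivalence)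
open import Relation.Nullary using (¬_; yes; no)
open import Relation.Binary.Definitions using (tri<; tri≈; tri>)
open import Relation.Binary.PropositionalEquality

toℚ≡mkℚ : ∀ n → toℚ n ≡ mkℚ (ℤ.+ n) 0 (Coprime.sym (1-coprimeTo n))
toℚ≡mkℚ n = ℚP.normalize-coprime (Coprime.sym (1-coprimeTo n))

toℚ-suc : ∀ n → toℚ (suc n) ≡ 1ℚ + toℚ n
toℚ-suc n = ℚP.toℚᵘ-injective (begin
  toℚᵘ (toℚ (suc n))             ≈⟨ ℚᵘP.≃-reflexive (cong toℚᵘ (toℚ≡mkℚ (suc n))) ⟩
  ℚᵘ.mkℚᵘ (ℤ.+ suc n) 0          ≈⟨ ℚᵘ.*≡* (solve 1 (λ x → (con 1ℤ :+ x) :* (con 1ℤ :* con 1ℤ)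
                                                        := (con 1ℤ :* con 1ℤ :+ x :* con 1ℤ) :* con 1ℤ) refl (ℤ.+ n)) ⟩
  ℚᵘ.1ℚᵘ ℚᵘ.+ ℚᵘ.mkℚᵘ (ℤ.+ n) 0  ≈⟨ ℚᵘP.+-congʳ ℚᵘ.1ℚᵘ (ℚᵘP.≃-reflexive (cong toℚᵘ (sym (toℚ≡mkℚ n)))) ⟩
  ℚᵘ.1ℚᵘ ℚᵘ.+ toℚᵘ (toℚ n)       ≈⟨ ℚᵘP.≃-sym (ℚP.toℚᵘ-homo-+ 1ℚ (toℚ n)) ⟩
  toℚᵘ (1ℚ + toℚ n)              ∎)
  where
  open ℚᵘP.≃-Reasoning
  open ℤSolver

toℚ-+ : ∀ m n → toℚ (m ℕ.+ n) ≡ toℚ m + toℚ n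
toℚ-+ zero    n = sym (ℚP.+-identityˡ (toℚ n))
toℚ-+ (suc m) n = begin
  toℚ (suc (m ℕ.+ n))        ≡⟨ toℚ-suc (m ℕ.+ n) ⟩
  1ℚ + toℚ (m ℕ.+ n)         ≡⟨ cong (1ℚ +_) (toℚ-+ m n) ⟩
  1ℚ + (toℚ m + toℚ n)       ≡⟨ ℚP.+-assoc 1ℚ (toℚ m) (toℚ n) ⟨
  (1ℚ + toℚ m) + toℚ n       ≡⟨ cong (_+ toℚ n) (toℚ-suc m) ⟨
  toℚ (suc m) + toℚ n        ∎
  where open ≡-Reasoning

toℚ-* : ∀ m n → toℚ (m ℕ.* n) ≡ toℚ m * toℚ n
toℚ-* zero    n = sym (ℚP.*-zeroˡ (toℚ n))
toℚ-* (suc m) n = begin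
  toℚ (n ℕ.+ m ℕ.* n)        ≡⟨ toℚ-+ n (m ℕ.* n) ⟩
  toℚ n + toℚ (m ℕ.* n)      ≡⟨ cong (toℚ n +_) (toℚ-* m n) ⟩
  toℚ n + toℚ m * toℚ n      ≡⟨ cong (_+ toℚ m * toℚ n) (ℚP.*-identityˡ (toℚ n)) ⟨
  1ℚ * toℚ n + toℚ m * toℚ n ≡⟨ ℚP.*-distribʳ-+ (toℚ n) 1ℚ (toℚ m) ⟨
  (1ℚ + toℚ m) * toℚ n       ≡⟨ cong (_* toℚ n) (toℚ-suc m) ⟨
  toℚ (suc m) * toℚ n        ∎
  where open ≡-Reasoning

toℚ-mono-≤ : ∀ {m n} → m ≤ n → toℚ m ℚ.≤ toℚ n
toℚ-mono-≤ {m} {n} m≤n rewrite toℚ≡mkℚ m | toℚ≡mkℚ n =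
  ℚ.*≤* (ℤP.*-monoʳ-≤-nonNeg (ℤ.+ 1) (ℤ.+≤+ m≤n))

toℚ-mono-< : ∀ {m n} → m < n → toℚ m ℚ.< toℚ n
toℚ-mono-< {m} {n} m<n rewrite toℚ≡mkℚ m | toℚ≡mkℚ n =
  ℚ.*<* (ℤP.*-monoʳ-<-pos (ℤ.+ 1) (ℤ.+<+ m<n))

prepend : ∀ {n} → (Fin n → ℕ) → (ℕ → ℕ) → ℕ → ℕ
prepend {zero}  b x i       = x i
prepend {suc n} b x zero    = b F.zero
prepend {suc n} b x (suc i) = prepend (b ∘ F.suc) x i

prepend-lookup : ∀ {n} (b : Fin n → ℕ) x {i} (i<n : i < n) → prepend b x i ≡ b (F.fromℕ< i<n)
prepend-lookup {suc n} b x {zero}  _         = refl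
prepend-lookup {suc n} b x {suc i} (s≤s i<n) = prepend-lookup (b ∘ F.suc) x i<n

prepend-drop : ∀ {n} (b : Fin n → ℕ) x t → prepend b x (n ℕ.+ t) ≡ x t
prepend-drop {zero}  b x t = refl
prepend-drop {suc n} b x t = prepend-drop (b ∘ F.suc) x t

prepend-all : ∀ {P : ℕ → Set} {n} {b : Fin n → ℕ} {x} → (∀ i → P (b i)) → (∀ i → P (x i)) → ∀ i → P (prepend b x i)
prepend-all             {n = zero}  Pb Px i       = Px i
prepend-all             {n = suc n} Pb Px zero    = Pb F.zero
prepend-all {P = P} {n = suc n} Pb Px (suc i) = prepend-all {P = P} (Pb ∘ F.suc) Px i

S≡Sfin : ∀ r {n} (b : Fin n → ℕ) x → (∀ {i} (i<n : i < n) → x i ≡ b (F.fromℕ< i<n)) → S r x n ≡ Sfin r b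
S≡Sfin r {zero}  b x x≡b = refl
S≡Sfin r {suc n} b x x≡b = cong₂ _+_ (S≡Sfin r (b ∘ F.inject₁) x x≡b∘inject₁)
                                     (cong (λ a → toℚ a * w r (suc n)) (trans (x≡b ℕP.≤-refl) (cong b (sym (FP.fromℕ-def n)))))
  where
  x≡b∘inject₁ : ∀ {i} (i<n : i < n) → x i ≡ b (F.inject₁ (F.fromℕ< i<n))
  x≡b∘inject₁ {i} i<n = trans (x≡b (ℕP.m<n⇒m<1+n i<n)) (cong b (FP.toℕ-injective (begin
    F.toℕ (F.fromℕ< (ℕP.m<n⇒m<1+n i<n))  ≡⟨ FP.toℕ-fromℕ< _ ⟩
    i                                     ≡⟨ FP.toℕ-fromℕ< i<n ⟨
    F.toℕ (F.fromℕ< i<n)                  ≡⟨ FP.toℕ-inject₁ (F.fromℕ< i<n) ⟨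
    F.toℕ (F.inject₁ (F.fromℕ< i<n))      ∎)))
    where open ≡-Reasoning

pred-k∉gaps : ∀ {l} {k m : Fin l → ℕ} → (∀ i → k i < m i) → (∀ i j → i F.< j → m i < k j) →
              ∀ {j a} → suc a ≡ k j → ∀ i → ¬ (k i ≤ a × a < m i)
pred-k∉gaps {k = k} {m} k<m m<k {j} {a} a+1≡kj i (ki≤a , a<mi) with FP.<-cmp i j
... | tri< i<j _ _ = ℕP.<⇒≱ a<mi (ℕ.s≤s⁻¹ (subst (m i <_) (sym a+1≡kj) (m<k i j i<j)))
... | tri≈ _ refl _ = ℕP.<⇒≱ (ℕP.≤-reflexive a+1≡kj) ki≤a
... | tri> _ _ j<i = ℕP.<-irrefl refl (begin-strict
  m j  <⟨ m<k j i j<i ⟩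
  k i  ≤⟨ ki≤a ⟩
  a    <⟨ ℕP.≤-reflexive a+1≡kj ⟩
  k j  <⟨ k<m j ⟩
  m j  ∎)
  where open ℕP.≤-Reasoning

-- Parametrised by r − 1 so that inv r, defined by cases on r, computes.
module Radix (r₀ : ℕ) where

  r : ℕ
  r = suc r₀

  infix 8 _/r^_
  _/r^_ : ℕ → ℕ → ℚ
  X /r^ N = toℚ X * w r N

  r*inv[r]≡1 : toℚ r * inv r ≡ 1ℚ
  r*inv[r]≡1 = ℚP.toℚᵘ-injective (begin
    toℚᵘ (toℚ r * inv r)                       ≈⟨ ℚP.toℚᵘ-homo-* (toℚ r) (inv r) ⟩
    toℚᵘ (toℚ r) ℚᵘ.* toℚᵘ (inv r)             ≈⟨ ℚᵘP.*-cong (ℚᵘP.≃-reflexive (cong toℚᵘ (toℚ≡mkℚ r)))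
                                                     (ℚᵘP.≃-reflexive (cong toℚᵘ (ℚP.normalize-coprime (1-coprimeTo r)))) ⟩
    ℚᵘ.mkℚᵘ (ℤ.+ r) 0 ℚᵘ.* ℚᵘ.mkℚᵘ (ℤ.+ 1) r₀  ≈⟨ ℚᵘ.*≡* (solve 1 (λ x → x :* con 1ℤ :* con 1ℤ := con 1ℤ :* (con 1ℤ :* x)) refl (ℤ.+ r)) ⟩
    ℚᵘ.1ℚᵘ                                     ∎)
    where
    open ℚᵘP.≃-Reasoning
    open ℤSolver

  w-positive : ∀ N → ℚ.Positive (w r N)
  w-positive zero    = _
  w-positive (suc N) = ℚP.pos*pos⇒pos (inv r) {{inv-pos}} (w r N) {{w-positive N}}
    where
    inv-pos : ℚ.Positive (inv r)
    inv-pos = subst ℚ.Positive (sym (ℚP.normalize-coprime (1-coprimeTo r))) _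

  w-suc : ∀ N → w r N ≡ toℚ r * w r (suc N)
  w-suc N = begin
    w r N                    ≡⟨ ℚP.*-identityˡ (w r N) ⟨
    1ℚ * w r N               ≡⟨ cong (_* w r N) r*inv[r]≡1 ⟨
    toℚ r * inv r * w r N    ≡⟨ ℚP.*-assoc (toℚ r) (inv r) (w r N) ⟩
    toℚ r * w r (suc N)      ∎
    where open ≡-Reasoning

  w-pow : ∀ t N → w r N ≡ toℚ (r ^ t) * w r (t ℕ.+ N)
  w-pow zero    N = sym (ℚP.*-identityˡ (w r N))
  w-pow (suc t) N = begin
    w r N                                         ≡⟨ w-pow t N ⟩
    toℚ (r ^ t) * w r (t ℕ.+ N)                   ≡⟨ cong (toℚ (r ^ t) *_) (w-suc (t ℕ.+ N)) ⟩
    toℚ (r ^ t) * (toℚ r * w r (suc t ℕ.+ N))     ≡⟨ ℚP.*-assoc (toℚ (r ^ t)) (toℚ r) _ ⟨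
    toℚ (r ^ t) * toℚ r * w r (suc t ℕ.+ N)       ≡⟨ cong (_* w r (suc t ℕ.+ N)) (toℚ-* (r ^ t) r) ⟨
    toℚ (r ^ t ℕ.* r) * w r (suc t ℕ.+ N)         ≡⟨ cong (λ X → toℚ X * w r (suc t ℕ.+ N)) (ℕP.*-comm (r ^ t) r) ⟩
    toℚ (r ^ suc t) * w r (suc t ℕ.+ N)           ∎
    where open ≡-Reasoning

  /r^-rescale : ∀ X N t → X /r^ N ≡ (X ℕ.* r ^ t) /r^ (t ℕ.+ N)
  /r^-rescale X N t = begin
    toℚ X * w r N                          ≡⟨ cong (toℚ X *_) (w-pow t N) ⟩
    toℚ X * (toℚ (r ^ t) * w r (t ℕ.+ N))  ≡⟨ ℚP.*-assoc (toℚ X) (toℚ (r ^ t)) _ ⟨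
    toℚ X * toℚ (r ^ t) * w r (t ℕ.+ N)    ≡⟨ cong (_* w r (t ℕ.+ N)) (toℚ-* X (r ^ t)) ⟨
    toℚ (X ℕ.* r ^ t) * w r (t ℕ.+ N)      ∎
    where open ≡-Reasoning

  /r^-step : ∀ P a N → P /r^ N + a /r^ suc N ≡ (r ℕ.* P ℕ.+ a) /r^ suc N
  /r^-step P a N = begin
    toℚ P * w r N + toℚ a * w r (suc N)                 ≡⟨ cong (λ q → toℚ P * q + toℚ a * w r (suc N)) (w-suc N) ⟩
    toℚ P * (toℚ r * w r (suc N)) + toℚ a * w r (suc N) ≡⟨ solve 4 (λ p ρ v a → p :* (ρ :* v) :+ a :* v := (ρ :* p :+ a) :* v)
                                                             refl (toℚ P) (toℚ r) (w r (suc N)) (toℚ a) ⟩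
    (toℚ r * toℚ P + toℚ a) * w r (suc N)               ≡⟨ cong (λ q → (q + toℚ a) * w r (suc N)) (toℚ-* r P) ⟨
    (toℚ (r ℕ.* P) + toℚ a) * w r (suc N)               ≡⟨ cong (_* w r (suc N)) (toℚ-+ (r ℕ.* P) a) ⟨
    toℚ (r ℕ.* P ℕ.+ a) * w r (suc N)                   ∎
    where
    open ≡-Reasoning
    open ℚSolver

  +/r^-∸/r^ : ∀ q {X Y} N → Y ≤ X → q + X /r^ N - (X ∸ Y) /r^ N ≡ q + Y /r^ N
  +/r^-∸/r^ q {X} {Y} N Y≤X = begin
    q + toℚ X * w r N - toℚ (X ∸ Y) * w r N                    ≡⟨ cong (λ e → q + toℚ e * w r N - toℚ (X ∸ Y) * w r N) (ℕP.m+[n∸m]≡n Y≤X) ⟨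
    q + toℚ (Y ℕ.+ (X ∸ Y)) * w r N - toℚ (X ∸ Y) * w r N      ≡⟨ cong (λ e → q + e * w r N - toℚ (X ∸ Y) * w r N) (toℚ-+ Y (X ∸ Y)) ⟩
    q + (toℚ Y + toℚ (X ∸ Y)) * w r N - toℚ (X ∸ Y) * w r N    ≡⟨ solve 4 (λ q y z v → q :+ (y :+ z) :* v :- z :* v := q :+ y :* v)
                                                                     refl q (toℚ Y) (toℚ (X ∸ Y)) (w r N) ⟩
    q + toℚ Y * w r N                                          ∎
    where
    open ≡-Reasoning
    open ℚSolver

  /r^-mono-≤ : ∀ X Y N → X ≤ Y → X /r^ N ℚ.≤ Y /r^ N
  /r^-mono-≤ X Y N X≤Y = ℚP.*-monoʳ-≤-nonNeg (w r N) {{ℚP.pos⇒nonNeg (w r N) {{w-positive N}}}} (toℚ-mono-≤ X≤Y)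

  /r^-mono-< : ∀ X Y N → X < Y → X /r^ N ℚ.< Y /r^ N
  /r^-mono-< X Y N X<Y = ℚP.*-monoˡ-<-pos (w r N) {{w-positive N}} (toℚ-mono-< X<Y)

  private
    /r^-common : ∀ Y N M → Y /r^ M ≡ (Y ℕ.* r ^ N) /r^ (M ℕ.+ N)
    /r^-common Y N M = trans (/r^-rescale Y M N) (cong ((Y ℕ.* r ^ N) /r^_) (ℕP.+-comm N M))

  /r^-≤ : ∀ X Y N M → X ℕ.* r ^ M ≤ Y ℕ.* r ^ N → X /r^ N ℚ.≤ Y /r^ M
  /r^-≤ X Y N M h = subst₂ ℚ._≤_ (sym (/r^-rescale X N M)) (sym (/r^-common Y N M)) (/r^-mono-≤ _ _ (M ℕ.+ N) h)

  /r^-<⁻¹ : ∀ X Y N M → X /r^ N ℚ.< Y /r^ M → X ℕ.* r ^ M < Y ℕ.* r ^ N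
  /r^-<⁻¹ X Y N M h = ℕP.≰⇒> (λ Y≤X → ℚP.<-irrefl refl (ℚP.<-≤-trans h (/r^-≤ Y X M N Y≤X)))

  numeral : (ℕ → ℕ) → ℕ → ℕ
  numeral x zero    = 0
  numeral x (suc N) = r ℕ.* numeral x N ℕ.+ x N

  S≡numeral/r^ : ∀ x N → S r x N ≡ numeral x N /r^ N
  S≡numeral/r^ x zero    = sym (ℚP.*-zeroˡ 1ℚ)
  S≡numeral/r^ x (suc N) = trans (cong (_+ x N /r^ suc N) (S≡numeral/r^ x N)) (/r^-step (numeral x N) (x N) N)

  S+w≡suc-numeral/r^ : ∀ x N → S r x N + w r N ≡ suc (numeral x N) /r^ N
  S+w≡suc-numeral/r^ x N = begin
    S r x N + w r N                       ≡⟨ cong (_+ w r N) (S≡numeral/r^ x N) ⟩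
    toℚ (numeral x N) * w r N + w r N     ≡⟨ solve 2 (λ X v → X :* v :+ v := (con 1ℚ :+ X) :* v) refl (toℚ (numeral x N)) (w r N) ⟩
    (1ℚ + toℚ (numeral x N)) * w r N      ≡⟨ cong (_* w r N) (toℚ-suc (numeral x N)) ⟨
    suc (numeral x N) /r^ N               ∎
    where
    open ≡-Reasoning
    open ℚSolver

  r*-suc : ∀ m → r ℕ.* suc m ≡ r ℕ.* m ℕ.+ r
  r*-suc m = trans (ℕP.*-suc r m) (ℕP.+-comm r (r ℕ.* m))

  numeral-*^-≤ : ∀ x N t → numeral x N ℕ.* r ^ t ≤ numeral x (t ℕ.+ N)
  numeral-*^-≤ x N zero    = ℕP.≤-reflexive (ℕP.*-identityʳ (numeral x N))
  numeral-*^-≤ x N (suc t) = begin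
    numeral x N ℕ.* (r ℕ.* r ^ t)  ≡⟨ x∙yz≈y∙xz (numeral x N) r (r ^ t) ⟩
    r ℕ.* (numeral x N ℕ.* r ^ t)  ≤⟨ ℕP.*-monoʳ-≤ r (numeral-*^-≤ x N t) ⟩
    r ℕ.* numeral x (t ℕ.+ N)      ≤⟨ ℕP.m≤m+n _ _ ⟩
    numeral x (suc t ℕ.+ N)        ∎
    where open ℕP.≤-Reasoning

  numeral-suc-≤ : ∀ {x} → (∀ i → x i < r) → ∀ N t → suc (numeral x (t ℕ.+ N)) ≤ suc (numeral x N) ℕ.* r ^ t
  numeral-suc-≤ {x} digits N zero    = ℕP.≤-reflexive (sym (ℕP.*-identityʳ _))
  numeral-suc-≤ {x} digits N (suc t) = begin
    suc (r ℕ.* numeral x (t ℕ.+ N) ℕ.+ x (t ℕ.+ N))  ≡⟨ ℕP.+-suc _ _ ⟨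
    r ℕ.* numeral x (t ℕ.+ N) ℕ.+ suc (x (t ℕ.+ N))  ≤⟨ ℕP.+-monoʳ-≤ _ (digits (t ℕ.+ N)) ⟩
    r ℕ.* numeral x (t ℕ.+ N) ℕ.+ r                  ≡⟨ r*-suc _ ⟨
    r ℕ.* suc (numeral x (t ℕ.+ N))                  ≤⟨ ℕP.*-monoʳ-≤ r (numeral-suc-≤ digits N t) ⟩
    r ℕ.* (suc (numeral x N) ℕ.* r ^ t)              ≡⟨ x∙yz≈y∙xz r (suc (numeral x N)) (r ^ t) ⟩
    suc (numeral x N) ℕ.* r ^ suc t                  ∎
    where open ℕP.≤-Reasoning

  numeral-top-tail : ∀ {x N} → (∀ t → x (t ℕ.+ N) ≡ r₀) → ∀ t → suc (numeral x (t ℕ.+ N)) ≡ suc (numeral x N) ℕ.* r ^ t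
  numeral-top-tail {x} {N} top zero    = sym (ℕP.*-identityʳ _)
  numeral-top-tail {x} {N} top (suc t) = begin
    suc (r ℕ.* numeral x (t ℕ.+ N) ℕ.+ x (t ℕ.+ N))  ≡⟨ cong (λ a → suc (r ℕ.* numeral x (t ℕ.+ N) ℕ.+ a)) (top t) ⟩
    suc (r ℕ.* numeral x (t ℕ.+ N) ℕ.+ r₀)           ≡⟨ ℕP.+-suc _ _ ⟨
    r ℕ.* numeral x (t ℕ.+ N) ℕ.+ r                  ≡⟨ r*-suc _ ⟨
    r ℕ.* suc (numeral x (t ℕ.+ N))                  ≡⟨ cong (r ℕ.*_) (numeral-top-tail top t) ⟩
    r ℕ.* (suc (numeral x N) ℕ.* r ^ t)              ≡⟨ x∙yz≈y∙xz r (suc (numeral x N)) (r ^ t) ⟩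
    suc (numeral x N) ℕ.* r ^ suc t                  ∎
    where open ≡-Reasoning

  _++[_]++top : ∀ {n} → (Fin n → ℕ) → ℕ → ℕ → ℕ
  b ++[ a ]++top = prepend b (prepend {1} (λ _ → a) (λ _ → r₀))

  ++top-tail : ∀ {n} (b : Fin n → ℕ) a t → (b ++[ a ]++top) (t ℕ.+ suc n) ≡ r₀
  ++top-tail {n} b a t = trans (cong (b ++[ a ]++top) (trans (ℕP.+-comm t (suc n)) (sym (ℕP.+-suc n t))))
                              (prepend-drop b _ (suc t))

  suc-numeral-++top : ∀ {n} (b : Fin n → ℕ) a →
                      suc (numeral (b ++[ a ]++top) (suc n)) ≡ r ℕ.* numeral (b ++[ a ]++top) n ℕ.+ suc a
  suc-numeral-++top {n} b a = trans (sym (ℕP.+-suc _ _)) (cong (λ e → r ℕ.* numeral (b ++[ a ]++top) n ℕ.+ suc e)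
    (trans (cong (b ++[ a ]++top) (sym (ℕP.+-identityʳ n))) (prepend-drop b _ 0)))

  Sfin+/r^≡numeral-++top : ∀ {n} (b : Fin n → ℕ) a e →
                            Sfin r b + e /r^ suc n ≡ (r ℕ.* numeral (b ++[ a ]++top) n ℕ.+ e) /r^ suc n
  Sfin+/r^≡numeral-++top {n} b a e = begin
    Sfin r b + e /r^ suc n                                   ≡⟨ cong (_+ e /r^ suc n) (S≡Sfin r b _ (prepend-lookup b _)) ⟨
    S r (b ++[ a ]++top) n + e /r^ suc n                     ≡⟨ cong (_+ e /r^ suc n) (S≡numeral/r^ (b ++[ a ]++top) n) ⟩
    numeral (b ++[ a ]++top) n /r^ n + e /r^ suc n           ≡⟨ /r^-step (numeral (b ++[ a ]++top) n) e n ⟩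
    (r ℕ.* numeral (b ++[ a ]++top) n ℕ.+ e) /r^ suc n       ∎
    where open ≡-Reasoning

  ++top-value : ∀ {n} (b : Fin n → ℕ) a → suc (numeral (b ++[ a ]++top) (suc n)) /r^ suc n ≡ Sfin r b + suc a /r^ suc n
  ++top-value {n} b a = trans (cong (_/r^ suc n) (suc-numeral-++top b a)) (sym (Sfin+/r^≡numeral-++top b a (suc a)))

  ++top<Sfin+ : ∀ {n} (b : Fin n → ℕ) {a e} → suc a < e → SeqLtQ r (b ++[ a ]++top) (Sfin r b + e /r^ suc n)
  ++top<Sfin+ {n} b {a} {e} a<e = suc n , subst (ℚ._< Sfin r b + e /r^ suc n)
    (sym (trans (S+w≡suc-numeral/r^ (b ++[ a ]++top) (suc n)) (++top-value b a)))
    (ℚP.+-monoʳ-< (Sfin r b) (/r^-mono-< (suc a) e (suc n) a<e))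

  numeral-below-gap : ∀ {A a P k m} → a < r → m ≤ r → ¬ (k ≤ a × a < m) →
                      r ℕ.* A ℕ.+ a < r ℕ.* P ℕ.+ m → r ℕ.* A ℕ.+ a < r ℕ.* P ℕ.+ k
  numeral-below-gap {A} {a} {P} {k} {m} a<r m≤r a∉gap lt with ℕP.<-cmp A P
  ... | tri< A<P _ _ = begin-strict
    r ℕ.* A ℕ.+ a  <⟨ ℕP.+-monoʳ-< (r ℕ.* A) a<r ⟩
    r ℕ.* A ℕ.+ r  ≡⟨ r*-suc A ⟨
    r ℕ.* suc A    ≤⟨ ℕP.*-monoʳ-≤ r A<P ⟩
    r ℕ.* P        ≤⟨ ℕP.m≤m+n (r ℕ.* P) k ⟩
    r ℕ.* P ℕ.+ k  ∎
    where open ℕP.≤-Reasoning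
  ... | tri≈ _ refl _ = ℕP.+-monoʳ-< (r ℕ.* A) (ℕP.≰⇒> (λ k≤a → a∉gap (k≤a , ℕP.+-cancelˡ-< (r ℕ.* A) a m lt)))
  ... | tri> _ _ P<A = ⊥-elim (ℕP.<⇒≱ lt (begin
    r ℕ.* P ℕ.+ m  ≤⟨ ℕP.+-monoʳ-≤ (r ℕ.* P) m≤r ⟩
    r ℕ.* P ℕ.+ r  ≡⟨ r*-suc P ⟨
    r ℕ.* suc P    ≤⟨ ℕP.*-monoʳ-≤ r P<A ⟩
    r ℕ.* A        ≤⟨ ℕP.m≤m+n (r ℕ.* A) a ⟩
    r ℕ.* A ℕ.+ a  ∎))
    where open ℕP.≤-Reasoning

  module _ {x : ℕ → ℕ} (digits : ∀ i → x i < r) where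

    private
      <-suc*r^ : ∀ X N → X ℕ.* r ^ N < suc X ℕ.* r ^ N
      <-suc*r^ X N = ℕP.*-monoˡ-< (r ^ N) {{ℕP.m^n≢0 r N}} (ℕP.n<1+n X)

      numeral-cross-≤ : ∀ N t → numeral x N ℕ.* r ^ (t ℕ.+ N) < suc (numeral x (t ℕ.+ N)) ℕ.* r ^ N
      numeral-cross-≤ N t = begin-strict
        numeral x N ℕ.* r ^ (t ℕ.+ N)        ≡⟨ cong (numeral x N ℕ.*_) (ℕP.^-distribˡ-+-* r t N) ⟩
        numeral x N ℕ.* (r ^ t ℕ.* r ^ N)    ≡⟨ ℕP.*-assoc (numeral x N) (r ^ t) (r ^ N) ⟨
        numeral x N ℕ.* r ^ t ℕ.* r ^ N      ≤⟨ ℕP.*-monoˡ-≤ (r ^ N) (numeral-*^-≤ x N t) ⟩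
        numeral x (t ℕ.+ N) ℕ.* r ^ N        <⟨ <-suc*r^ (numeral x (t ℕ.+ N)) N ⟩
        suc (numeral x (t ℕ.+ N)) ℕ.* r ^ N  ∎
        where open ℕP.≤-Reasoning

      numeral-cross-≥ : ∀ M t → numeral x (t ℕ.+ M) ℕ.* r ^ M < suc (numeral x M) ℕ.* r ^ (t ℕ.+ M)
      numeral-cross-≥ M t = begin-strict
        numeral x (t ℕ.+ M) ℕ.* r ^ M          <⟨ <-suc*r^ (numeral x (t ℕ.+ M)) M ⟩
        suc (numeral x (t ℕ.+ M)) ℕ.* r ^ M    ≤⟨ ℕP.*-monoˡ-≤ (r ^ M) (numeral-suc-≤ digits M t) ⟩
        suc (numeral x M) ℕ.* r ^ t ℕ.* r ^ M  ≡⟨ ℕP.*-assoc (suc (numeral x M)) (r ^ t) (r ^ M) ⟩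
        suc (numeral x M) ℕ.* (r ^ t ℕ.* r ^ M) ≡⟨ cong (suc (numeral x M) ℕ.*_) (ℕP.^-distribˡ-+-* r t M) ⟨
        suc (numeral x M) ℕ.* r ^ (t ℕ.+ M)    ∎
        where open ℕP.≤-Reasoning

    -- The intervals [S r x N, S r x N + w r N] pairwise overlap.
    numeral-cross : ∀ N M → numeral x N ℕ.* r ^ M < suc (numeral x M) ℕ.* r ^ N
    numeral-cross N M with ℕP.≤-total N M
    ... | inj₁ N≤M = subst (λ M → numeral x N ℕ.* r ^ M < suc (numeral x M) ℕ.* r ^ N)
                           (ℕP.m∸n+n≡m N≤M) (numeral-cross-≤ N (M ∸ N))
    ... | inj₂ M≤N = subst (λ N → numeral x N ℕ.* r ^ M < suc (numeral x M) ℕ.* r ^ N)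
                           (ℕP.m∸n+n≡m M≤N) (numeral-cross-≥ M (N ∸ M))

    SeqLtQ⇒numeral< : ∀ {D n} → SeqLtQ r x (D /r^ n) → numeral x n < D
    SeqLtQ⇒numeral< {D} {n} (N , x<d) = ℕP.*-cancelʳ-< _ _ _ (begin-strict
      numeral x n ℕ.* r ^ N        <⟨ numeral-cross n N ⟩
      suc (numeral x N) ℕ.* r ^ n  <⟨ /r^-<⁻¹ (suc (numeral x N)) D N n (subst (ℚ._< D /r^ n) (S+w≡suc-numeral/r^ x N) x<d) ⟩
      D ℕ.* r ^ N                  ∎)
      where open ℕP.≤-Reasoning

    numeral<⇒S≤ : ∀ {Q n} → numeral x n < Q → ∀ N → S r x N ℚ.≤ Q /r^ n
    numeral<⇒S≤ {Q} {n} x<Q N = subst (ℚ._≤ Q /r^ n) (sym (S≡numeral/r^ x N)) (/r^-≤ (numeral x N) Q N n (begin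
      numeral x N ℕ.* r ^ n        ≤⟨ ℕP.<⇒≤ (numeral-cross N n) ⟩
      suc (numeral x n) ℕ.* r ^ N  ≤⟨ ℕP.*-monoˡ-≤ (r ^ N) x<Q ⟩
      Q ℕ.* r ^ N                  ∎))
      where open ℕP.≤-Reasoning

    -- One digit deeper than both witnesses the gap is r ≥ 2 units wide, room enough for SeqLt.
    SeqLtQ⇒SeqLt-top-tail : 1 ≤ r₀ → ∀ {y n} → (∀ t → y (t ℕ.+ n) ≡ r₀) →
                            SeqLtQ r x (suc (numeral y n) /r^ n) → SeqLt r x y
    SeqLtQ⇒SeqLt-top-tail 1≤r₀ {y} {n} top (N , x<y) =
      L , subst₂ ℚ._<_ (sym (S+w≡suc-numeral/r^ x L)) (sym (S≡numeral/r^ y L)) (/r^-mono-< _ _ L x<y-at-L)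
      where
      L : ℕ
      L = suc N ℕ.+ n
      Q : ℕ
      Q = suc (numeral y n)
      gap : suc (numeral x N) ℕ.* r ^ n < Q ℕ.* r ^ N
      gap = /r^-<⁻¹ (suc (numeral x N)) Q N n (subst (ℚ._< Q /r^ n) (S+w≡suc-numeral/r^ x N) x<y)
      wide-gap : suc (numeral x L) ℕ.+ r ≤ suc (numeral y L)
      wide-gap = begin
        suc (numeral x L) ℕ.+ r                    ≡⟨ cong (λ M → suc (numeral x M) ℕ.+ r) (cong suc (ℕP.+-comm N n)) ⟩
        suc (numeral x (suc n ℕ.+ N)) ℕ.+ r        ≤⟨ ℕP.+-monoˡ-≤ r (numeral-suc-≤ digits N (suc n)) ⟩
        suc (numeral x N) ℕ.* r ^ suc n ℕ.+ r      ≡⟨ cong (ℕ._+ r) (x∙yz≈y∙xz (suc (numeral x N)) r (r ^ n)) ⟩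
        r ℕ.* (suc (numeral x N) ℕ.* r ^ n) ℕ.+ r  ≡⟨ r*-suc _ ⟨
        r ℕ.* suc (suc (numeral x N) ℕ.* r ^ n)    ≤⟨ ℕP.*-monoʳ-≤ r gap ⟩
        r ℕ.* (Q ℕ.* r ^ N)                        ≡⟨ x∙yz≈y∙xz r Q (r ^ N) ⟩
        Q ℕ.* r ^ suc N                            ≡⟨ numeral-top-tail top (suc N) ⟨
        suc (numeral y L)                          ∎
        where open ℕP.≤-Reasoning
      x<y-at-L : suc (numeral x L) < numeral y L
      x<y-at-L = begin
        suc (suc (numeral x L))   ≡⟨ ℕP.+-comm 1 (suc (numeral x L)) ⟩
        suc (numeral x L) ℕ.+ 1   ≤⟨ ℕP.+-monoʳ-≤ (suc (numeral x L)) 1≤r₀ ⟩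
        suc (numeral x L) ℕ.+ r₀  ≤⟨ ℕ.s≤s⁻¹ (subst (_≤ suc (numeral y L)) (ℕP.+-suc (suc (numeral x L)) r₀) wide-gap) ⟩
        numeral y L               ∎
        where open ℕP.≤-Reasoning

    ≤∧≮-top-tail⇒HasValue : 1 ≤ r₀ → ∀ {y n} → (∀ t → y (t ℕ.+ n) ≡ r₀) →
                             (∀ N → S r x N ℚ.≤ suc (numeral y n) /r^ n) → ¬ SeqLt r x y →
                             HasValue r x (suc (numeral y n) /r^ n)
    ≤∧≮-top-tail⇒HasValue 1≤r₀ {y} {n} top x≤y x≮y N = x≤y N , y≤S+w
      where
      y≤S+w : suc (numeral y n) /r^ n ℚ.≤ S r x N + w r N
      y≤S+w with suc (numeral y n) /r^ n ℚ.≤? S r x N + w r N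
      ... | yes y≤ = y≤
      ... | no  y≰ = ⊥-elim (x≮y (SeqLtQ⇒SeqLt-top-tail 1≤r₀ top (N , ℚP.≰⇒> y≰)))

    S≤-below-gap : ∀ {n} (b : Fin n → ℕ) {a e} → e ≤ r → ¬ (suc a ≤ x n × x n < e) →
                   SeqLtQ r x (Sfin r b + e /r^ suc n) → ∀ N → S r x N ℚ.≤ Sfin r b + suc a /r^ suc n
    S≤-below-gap {n} b {a} {e} e≤r x∉gap x<d =
      subst (λ q → ∀ N → S r x N ℚ.≤ q) (sym (Sfin+/r^≡numeral-++top b a (suc a)))
        (numeral<⇒S≤ (numeral-below-gap {A = numeral x n} {P = numeral (b ++[ a ]++top) n} (digits n) e≤r x∉gap
          (SeqLtQ⇒numeral< (subst (SeqLtQ r x) (Sfin+/r^≡numeral-++top b a e) x<d))))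

  CompInterval⇒HasValue : ∀ {K n} {b : Fin n → ℕ} {k e c d} → (∀ i → (b i < r) × ¬ K (b i)) →
                          1 ≤ k → ¬ K (k ∸ 1) → ¬ K r₀ → k < e → e ≤ r → (∀ {u} → k ≤ u → u < e → K u) →
                          d ≡ Sfin r b + e /r^ suc n → CompInterval r K c d → HasValue r c (Sfin r b + k /r^ suc n)
  CompInterval⇒HasValue {K} {b = b} {suc a} {e} {c} b-adm (s≤s z≤n) a∉K r₀∉K a<e e≤r gap⊆K refl
                        (c-adm , _ , c<d , nothing-between) =
    subst (HasValue r c) (++top-value b a)
      (≤∧≮-top-tail⇒HasValue c-digits 1≤r₀ (++top-tail b a)
        (subst (λ q → ∀ N → S r c N ℚ.≤ q) (sym (++top-value b a))
          (S≤-below-gap c-digits b e≤r (λ (k≤c , c<e) → proj₂ (c-adm _) (gap⊆K k≤c c<e)) c<d))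
        (λ c<y → nothing-between (b ++[ a ]++top) y-adm (c<y , ++top<Sfin+ b a<e)))
    where
    c-digits : ∀ i → c i < r
    c-digits = proj₁ ∘ c-adm
    1≤r₀ : 1 ≤ r₀
    1≤r₀ = ℕ.s≤s⁻¹ (ℕP.<-≤-trans (ℕP.≤-<-trans (s≤s z≤n) a<e) e≤r)
    y-adm : Admissible r K (b ++[ a ]++top)
    y-adm = prepend-all {P = Digit} b-adm
              (prepend-all {P = Digit} {n = 1} (λ _ → ℕP.<-trans (ℕP.n<1+n a) (ℕP.<-≤-trans a<e e≤r) , a∉K)
                                                (λ _ → ℕP.≤-refl , r₀∉K))
      where
      Digit : ℕ → Set
      Digit u = (u < r) × ¬ K u

corollary2p4 :
    (r : ℕ) → 3 ≤ r →
    (K : ℕ → Set) → (∀ x → K x → (1 ≤ x) × (x ≤ r ∸ 2)) → (∃ λ x → K x) →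
    (l : ℕ) (k m : Fin l → ℕ) →
    (∀ i → k i < m i) → (∀ i j → i F.< j → m i < k j) → (∀ i → m i < r) →
    (∀ x → K x ⇔ (∃ λ i → (k i ≤ x) × (x < m i))) →
    (d : ℚ) → InD r K d →
    (n' : ℕ) (b : Fin n' → ℕ) → (∀ i → (b i < r) × ¬ K (b i)) →
    (j : Fin l) →
    d ≡ Sfin r b + toℚ (m j) * w r (suc n') →
    ∀ c → CompInterval r K c d →
    HasValue r c (d - toℚ (m j ∸ k j) * w r (suc n'))
corollary2p4 r@(suc r₀@(suc (suc _))) (s≤s (s≤s (s≤s z≤n))) K K⊆[1,r-2] _ l k m k<m m<k m<r K⇔gaps
             _ _ n′ b b-adm j refl c gap =
  subst (HasValue r c) (sym (+/r^-∸/r^ (Sfin r b) (suc n′) (ℕP.<⇒≤ (k<m j))))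
    (CompInterval⇒HasValue b-adm 1≤kj kj-1∉K r-1∉K (k<m j) (ℕP.<⇒≤ (m<r j))
      (λ k≤u u<m → Equivalence.from (K⇔gaps _) (j , k≤u , u<m)) refl gap)
  where
  open Radix r₀ hiding (r)
  1≤kj : 1 ≤ k j
  1≤kj = proj₁ (K⊆[1,r-2] (k j) (Equivalence.from (K⇔gaps (k j)) (j , ℕP.≤-refl , k<m j)))
  kj-1∉K : ¬ K (k j ∸ 1)
  kj-1∉K K[kj-1] = let i , in-gap = Equivalence.to (K⇔gaps _) K[kj-1] in
    pred-k∉gaps k<m m<k (ℕP.m+[n∸m]≡n 1≤kj) i in-gap
  r-1∉K : ¬ K r₀
  r-1∉K K[r-1] = ℕP.<-irrefl refl (proj₂ (K⊆[1,r-2] _ K[r-1]))
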